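{- Let $n$ and $q$ be integers with $n>q>0$, and let $p$ be a prime with $p\equiv 1 \pmod q$. Then \[ \operatorname{ord}_p\Big[\gcd_{0<k<n/q} \binom{n}{qk}\Big] = \begin{cases} 1 & \text{if } \alpha_p(n)\le q,\\ 0 & \text{otherwise,} \end{cases} \] where the greatest common divisor is taken over all integers $k$ with $0<k<n/q$.
   Context: For a nonzero integer $m$ and a prime $p$, $\operatorname{ord}_p(m)$ denotes the exponent of the highest power of $p$ dividing $m$. For a positive integer $n$, $\alpha_p(n)$ denotes the sum of the digits of the base-$p$ expansion of $n$; equivalently, it is the smallest integer $r$ such that $n=p^{i_1}+\cdots+p^{i_r}$ for some integers $0\le i_1\le\cdots\le i_r$. -}

module Defs where

open import Data.Nat using (ℕ; zero; suc; _+_; _*_; _^_; _<_; _≤_; _≤ᵇ_; NonZero)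
open import Data.Nat.DivMod using (_/_; _%_)
open import Data.Nat.Divisibility using (_∣_)
open import Data.Nat.GCD using (gcd)
open import Data.Nat.Combinatorics using (_C_)
open import Data.List using (List; []; _∷_; foldr; map; filter; upTo)
open import Data.Product using (_×_)
open import Relation.Nullary using (¬_)
open import Data.Nat using (_<?_)

IsOrd : ℕ → ℕ → ℕ → Set
IsOrd p m e = (p ^ e) ∣ m × ¬ ((p ^ suc e) ∣ m)

-- sum of base-p digits of n, computed with fuel (fuel ≥ n suffices when p ≥ 2)
digitSumAux : ℕ → (p : ℕ) → .{{NonZero p}} → ℕ → ℕ
digitSumAux zero    p n = 0
digitSumAux (suc f) p zero = 0
digitSumAux (suc f) p n@(suc _) = n % p + digitSumAux f p (n / p)

α : (p : ℕ) → .{{NonZero p}} → ℕ → ℕ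
α p n = digitSumAux n p n

gcdList : List ℕ → ℕ
gcdList = foldr gcd 0

-- gcd over 0 < k < n/q (i.e. 1 ≤ k and q*k < n) of binom(n, q*k)
gcdBinom : ℕ → ℕ → ℕ
gcdBinom n q = gcdList (map (λ k → n C (q * k)) (filter (λ k → q * k <? n) (map suc (upTo n))))

-- By Legendre's formula e (p - 1) = n - α n for the exponent e of p in n!, the exponent of p in
-- binom(m + r, m) is (α m + α r - α (m + r)) / (p - 1), the number of carries when adding m and r
-- in base p (Kummer).  As q ∣ p - 1 and n ≡ α n mod p - 1, q ∣ m iff q ∣ α m.  If α n ≤ q, each
-- term binom(n, m) of the gcd has q ∣ m, hence α m ≥ q ≥ α n, so adding m and n - m carries and p
-- divides the term; splitting n as m + r with α m = q and exactly one carry gives a term not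
-- divisible by p².  If α n > q, a split with α m = q and no carry gives a term prime to p.

module Submission where

open import Defs
open import Data.Bool using (true; false; if_then_else_)
open import Data.Empty using (⊥-elim)
open import Data.List using (List; []; _∷_; map; filter; upTo)
open import Data.List.Membership.Propositional using (_∈_)
open import Data.List.Membership.Propositional.Properties
  using (∈-map⁺; ∈-map⁻; ∈-filter⁺; ∈-filter⁻; ∈-upTo⁺)
open import Data.List.Relation.Unary.Any using (here; there)
open import Data.Nat
open import Data.Nat.Combinatorics using (_C_; nCk≡n!/k![n-k]!; k![n∸k]!∣n!)
open import Data.Nat.DivMod
open import Data.Nat.Divisibility
open import Data.Nat.GCD using (gcd; gcd[m,n]∣m; gcd[m,n]∣n; gcd-greatest)
open import Data.Nat.Induction using (<-rec)
open import Data.Nat.Primality using (Prime; euclidsLemma; prime⇒nonZero; prime⇒nonTrivial)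
open import Data.Nat.Properties
open import Data.Nat.Tactic.RingSolver using (solve-∀)
open import Data.Product using (_×_; _,_; proj₁; proj₂; ∃-syntax)
open import Data.Sum using (inj₁; inj₂; [_,_]′)
open import Function using (_∘_)
open import Relation.Nullary using (¬_; yes; no)
open import Relation.Nullary.Reflects using (ofʸ; ofⁿ)
open import Relation.Binary.PropositionalEquality

record Valuation (p m e : ℕ) : Set where
  constructor valuation
  field
    cofactor      : ℕ
    decomposition : m ≡ p ^ e * cofactor
    indivisible   : ¬ p ∣ cofactor

module _ {p : ℕ} .{{_ : NonZero p}} where

  Valuation⇒p^e∣ : ∀ {m e} → Valuation p m e → p ^ e ∣ m
  Valuation⇒p^e∣ {e = e} (valuation u m≡ _) = divides u (trans m≡ (*-comm (p ^ e) u))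

  Valuation⇒¬p^[1+e]∣ : ∀ {m e} → Valuation p m e → ¬ p ^ suc e ∣ m
  Valuation⇒¬p^[1+e]∣ {e = e} (valuation u m≡ p∤u) p^[1+e]∣m = p∤u (*-cancelˡ-∣ (p ^ e) {{m^n≢0 p e}} (begin
    p ^ e * p    ≡⟨ *-comm (p ^ e) p ⟩
    p ^ suc e    ∣⟨ p^[1+e]∣m ⟩
    _            ≡⟨ m≡ ⟩
    p ^ e * u    ∎))
    where open ∣-Reasoning

  p^m∣p^n : ∀ {m n} → m ≤ n → p ^ m ∣ p ^ n
  p^m∣p^n {m} {n} m≤n = divides (p ^ (n ∸ m)) (begin
    p ^ n                ≡⟨ cong (p ^_) (sym (m+[n∸m]≡n m≤n)) ⟩
    p ^ (m + (n ∸ m))    ≡⟨ ^-distribˡ-+-* p m (n ∸ m) ⟩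
    p ^ m * p ^ (n ∸ m)  ≡⟨ *-comm (p ^ m) _ ⟩
    p ^ (n ∸ m) * p ^ m  ∎)
    where open ≡-Reasoning

  Valuation-unique : ∀ {m e f} → Valuation p m e → Valuation p m f → e ≡ f
  Valuation-unique v v′ = ≤-antisym (≤-bound v′ v) (≤-bound v v′)
    where
    ≤-bound : ∀ {m e f} → Valuation p m e → Valuation p m f → f ≤ e
    ≤-bound v v′ = ≮⇒≥ (λ e<f → Valuation⇒¬p^[1+e]∣ v (∣-trans (p^m∣p^n e<f) (Valuation⇒p^e∣ v′)))

valuation-exists : ∀ {p} → 1 < p → ∀ m → 0 < m → ∃[ e ] Valuation p m e
valuation-exists {p} 1<p = <-rec (λ m → 0 < m → ∃[ e ] Valuation p m e) go
  where
  instance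
    p≢0 : NonZero p
    p≢0 = >-nonZero (<-trans z<s 1<p)

  go : ∀ m → (∀ {k} → k < m → 0 < k → ∃[ e ] Valuation p k e) → 0 < m → ∃[ e ] Valuation p m e
  go m _ _ with p ∣? m
  go m _ _ | no p∤m = 0 , valuation m (sym (*-identityˡ m)) p∤m
  go _ _ () | yes (divides zero refl)
  go _ rec _ | yes (divides k@(suc _) refl) with rec (m<m*n k p 1<p) z<s
  ... | e , valuation u k≡ p∤u = suc e , valuation u (begin
    k * p            ≡⟨ cong (_* p) k≡ ⟩
    p ^ e * u * p    ≡⟨ *-comm (p ^ e * u) p ⟩
    p * (p ^ e * u)  ≡⟨ *-assoc p (p ^ e) u ⟨
    p ^ suc e * u    ∎)
    p∤u
    where open ≡-Reasoning

Valuation-* : ∀ {p a b e f} → Prime p → Valuation p a e → Valuation p b f → Valuation p (a * b) (e + f)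
Valuation-* {p} {e = e} {f} pr (valuation u a≡ p∤u) (valuation w b≡ p∤w) =
  valuation (u * w) a*b≡ (λ p∣u*w → [ p∤u , p∤w ]′ (euclidsLemma u w pr p∣u*w))
  where
  open ≡-Reasoning
  interchange : ∀ a b c d → a * b * (c * d) ≡ a * c * (b * d)
  interchange = solve-∀
  a*b≡ : _ ≡ p ^ (e + f) * (u * w)
  a*b≡ = begin
    _                          ≡⟨ cong₂ _*_ a≡ b≡ ⟩
    p ^ e * u * (p ^ f * w)    ≡⟨ interchange (p ^ e) u (p ^ f) w ⟩
    p ^ e * p ^ f * (u * w)    ≡⟨ cong (_* (u * w)) (^-distribˡ-+-* p e f) ⟨
    p ^ (e + f) * (u * w)      ∎

module DigitSum (p : ℕ) .{{_ : NonZero p}} (1<p : 1 < p) where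

  p-1 : ℕ
  p-1 = pred p

  1+p-1≡p : suc p-1 ≡ p
  1+p-1≡p = suc-pred p

  p-1<p : p-1 < p
  p-1<p = subst (p-1 <_) 1+p-1≡p ≤-refl

  0<p : 0 < p
  0<p = <-trans z<s 1<p

  instance
    p-1≢0 : NonZero p-1
    p-1≢0 = >-nonZero (≤-pred (subst (1 <_) (sym 1+p-1≡p) 1<p))

  x*p≡x+x*p-1 : ∀ x → x * p ≡ x + x * p-1
  x*p≡x+x*p-1 x = trans (cong (x *_) (sym 1+p-1≡p)) (*-suc x p-1)

  private
    digitSumAux-zero : ∀ f → digitSumAux f p 0 ≡ 0
    digitSumAux-zero zero    = refl
    digitSumAux-zero (suc f) = refl

    n/p<n : ∀ n → .{{NonZero n}} → n / p < n
    n/p<n n = m/n<m n p 1<p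

    digitSumAux-fuel : ∀ {f g} n → n ≤ f → n ≤ g → digitSumAux f p n ≡ digitSumAux g p n
    digitSumAux-fuel {f} {g} zero _ _ = trans (digitSumAux-zero f) (sym (digitSumAux-zero g))
    digitSumAux-fuel {suc f} {suc g} n@(suc _) (s≤s n≤f) (s≤s n≤g) =
      cong (n % p +_) (digitSumAux-fuel (n / p) (≤-trans (<⇒≤pred (n/p<n n)) n≤f) (≤-trans (<⇒≤pred (n/p<n n)) n≤g))

  α-%-/ : ∀ n → α p n ≡ n % p + α p (n / p)
  α-%-/ zero = sym (cong₂ _+_ (m<n⇒m%n≡m 0<p) (cong (α p) (0/n≡0 p)))
  α-%-/ n@(suc _) = cong (n % p +_) (digitSumAux-fuel (n / p) (<⇒≤pred (n/p<n n)) ≤-refl)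

  α-digit : ∀ d x → d < p → α p (d + x * p) ≡ d + α p x
  α-digit d x d<p = begin
    α p (d + x * p)                        ≡⟨ α-%-/ (d + x * p) ⟩
    (d + x * p) % p + α p ((d + x * p) / p) ≡⟨ cong₂ (λ a b → a + α p b) [d+x*p]%p≡d [d+x*p]/p≡x ⟩
    d + α p x                              ∎
    where
    open ≡-Reasoning
    [d+x*p]%p≡d : (d + x * p) % p ≡ d
    [d+x*p]%p≡d = trans ([m+kn]%n≡m%n d x p) (m<n⇒m%n≡m d<p)
    [d+x*p]/p≡x : (d + x * p) / p ≡ x
    [d+x*p]/p≡x = trans (+-distrib-/-∣ʳ d (n∣m*n x)) (cong₂ _+_ (m<n⇒m/n≡0 d<p) (m*n/n≡m x p))

  α-single-digit : ∀ d → d < p → α p d ≡ d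
  α-single-digit d d<p = begin
    α p d              ≡⟨ cong (α p) (+-identityʳ d) ⟨
    α p (d + 0 * p)    ≡⟨ α-digit d 0 d<p ⟩
    d + 0              ≡⟨ +-identityʳ d ⟩
    d                  ∎
    where open ≡-Reasoning

  α-*p : ∀ x → α p (x * p) ≡ α p x
  α-*p x = α-digit 0 x 0<p

  digit-induction : (P : ℕ → Set) → P 0 → (∀ d x → d < p → P x → P (d + x * p)) → ∀ n → P n
  digit-induction P P0 step = <-rec P go
    where
    go : ∀ n → (∀ {m} → m < n → P m) → P n
    go zero      _   = P0
    go n@(suc _) rec = subst P (sym (m≡m%n+[m/n]*n n p)) (step (n % p) (n / p) (m%n<n n p) (rec (n/p<n n)))

  α-positive : ∀ n → 0 < n → 0 < α p n
  α-positive = digit-induction (λ n → 0 < n → 0 < α p n) (λ ()) step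
    where
    step : ∀ d x → d < p → (0 < x → 0 < α p x) → 0 < d + x * p → 0 < α p (d + x * p)
    step (suc d) x d<p _  _   = subst (0 <_) (sym (α-digit (suc d) x d<p)) z<s
    step zero    x d<p ih 0<n = subst (0 <_) (sym (α-digit 0 x d<p)) (ih (0<x x 0<n))
      where
      0<x : ∀ x → 0 < x * p → 0 < x
      0<x (suc _) _ = z<s

  α-mod-p-1 : ∀ n → ∃[ k ] n ≡ α p n + k * p-1
  α-mod-p-1 = digit-induction (λ n → ∃[ k ] n ≡ α p n + k * p-1) (0 , refl) step
    where
    rearrange : ∀ d a k x q → d + (a + k * q + x * q) ≡ d + a + (x + k) * q
    rearrange = solve-∀
    step : ∀ d x → d < p → ∃[ k ] x ≡ α p x + k * p-1 → ∃[ k ] d + x * p ≡ α p (d + x * p) + k * p-1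
    step d x d<p (k , x≡) = x + k , (begin
      d + x * p                            ≡⟨ cong (d +_) (x*p≡x+x*p-1 x) ⟩
      d + (x + x * p-1)                    ≡⟨ cong (λ y → d + (y + x * p-1)) x≡ ⟩
      d + (α p x + k * p-1 + x * p-1)      ≡⟨ rearrange d (α p x) k x p-1 ⟩
      d + α p x + (x + k) * p-1            ≡⟨ cong (_+ (x + k) * p-1) (α-digit d x d<p) ⟨
      α p (d + x * p) + (x + k) * p-1      ∎)
      where open ≡-Reasoning

  module _ {q : ℕ} (q∣p-1 : q ∣ p-1) where

    ∣⇒∣α : ∀ {n} → q ∣ n → q ∣ α p n
    ∣⇒∣α {n} q∣n with α-mod-p-1 n
    ... | k , n≡ = ∣m+n∣m⇒∣n (subst (q ∣_) (trans n≡ (+-comm (α p n) _)) q∣n) (∣-trans q∣p-1 (n∣m*n k))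

    ∣α⇒∣ : ∀ {n} → q ∣ α p n → q ∣ n
    ∣α⇒∣ {n} q∣αn with α-mod-p-1 n
    ... | k , n≡ = subst (q ∣_) (sym n≡) (∣m∣n⇒∣m+n q∣αn (∣-trans q∣p-1 (n∣m*n k)))

  α-pred-indivisible : ∀ m → ¬ p ∣ m → α p m ≡ suc (α p (pred m))
  α-pred-indivisible m p∤m with m % p in m%p≡ | m%n<n m p
  ... | zero  | _   = ⊥-elim (p∤m (m%n≡0⇒n∣m m p m%p≡))
  ... | suc d | d<p = begin
    α p m                      ≡⟨ cong (α p) m≡ ⟩
    α p (suc d + m / p * p)    ≡⟨ α-digit (suc d) (m / p) d<p ⟩
    suc (d + α p (m / p))      ≡⟨ cong suc (α-digit d (m / p) (<-trans (n<1+n d) d<p)) ⟨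
    suc (α p (d + m / p * p))  ≡⟨ cong (suc ∘ α p ∘ pred) m≡ ⟨
    suc (α p (pred m))         ∎
    where
    open ≡-Reasoning
    m≡ : m ≡ suc d + m / p * p
    m≡ = trans (m≡m%n+[m/n]*n m p) (cong (_+ m / p * p) m%p≡)

  private
    α-pred-*p : ∀ w v → 0 < w → α p w + v * p-1 ≡ suc (α p (pred w)) →
                α p (w * p) + suc v * p-1 ≡ suc (α p (pred (w * p)))
    α-pred-*p w@(suc w-1) v _ ih = begin
      α p (w * p) + suc v * p-1             ≡⟨ cong (_+ suc v * p-1) (α-*p w) ⟩
      α p w + suc v * p-1                   ≡⟨ rearrange (α p w) v p-1 ⟩
      α p w + v * p-1 + p-1                 ≡⟨ cong (_+ p-1) ih ⟩
      suc (α p w-1 + p-1)                   ≡⟨ cong suc (+-comm (α p w-1) p-1) ⟩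
      suc (p-1 + α p w-1)                   ≡⟨ cong suc (α-digit p-1 w-1 p-1<p) ⟨
      suc (α p (p-1 + w-1 * p))             ≡⟨ cong (λ z → suc (α p (pred (z + w-1 * p)))) 1+p-1≡p ⟩
      suc (α p (pred (w * p)))              ∎
      where
      open ≡-Reasoning
      rearrange : ∀ a v q → a + suc v * q ≡ a + v * q + q
      rearrange = solve-∀

  -- Subtracting 1 from p^v u turns its v trailing zero digits into p - 1.
  α-pred-p^v* : ∀ {u} → ¬ p ∣ u → ∀ v → α p (p ^ v * u) + v * p-1 ≡ suc (α p (pred (p ^ v * u)))
  α-pred-p^v* {zero} p∤u _ = ⊥-elim (p∤u (p ∣0))
  α-pred-p^v* {u} p∤u zero =
    subst (λ m → α p m + 0 ≡ suc (α p (pred m))) (sym (*-identityˡ u))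
      (trans (+-identityʳ (α p u)) (α-pred-indivisible u p∤u))
  α-pred-p^v* {u@(suc _)} p∤u (suc v) =
    subst (λ m → α p m + suc v * p-1 ≡ suc (α p (pred m))) p^v*u*p≡
      (α-pred-*p (p ^ v * u) v 0<p^v*u (α-pred-p^v* p∤u v))
    where
    p^v*u*p≡ : p ^ v * u * p ≡ p ^ suc v * u
    p^v*u*p≡ = trans (*-comm (p ^ v * u) p) (sym (*-assoc p (p ^ v) u))
    0<p^v*u : 0 < p ^ v * u
    0<p^v*u = >-nonZero⁻¹ _ {{m*n≢0 (p ^ v) u {{m^n≢0 p v}}}}

  α-pred-valuation : ∀ {m v} → Valuation p m v → α p m + v * p-1 ≡ suc (α p (pred m))
  α-pred-valuation {v = v} (valuation u refl p∤u) = α-pred-p^v* p∤u v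

  -- The base-p addition left + right = n has c carries exactly when the digit sums drop by c (p - 1).
  record CarrySplit (n t c : ℕ) : Set where
    field
      left right  : ℕ
      left+right  : left + right ≡ n
      α-left      : α p left ≡ t
      carries     : α p left + α p right ≡ α p n + c * p-1

  CarrySplit⇒0<right : ∀ {n t c} (s : CarrySplit n t c) → t < α p n + c * p-1 → 0 < CarrySplit.right s
  CarrySplit⇒0<right record { right = zero ; α-left = refl ; carries = carries } t<αn+c*p-1 =
    ⊥-elim (<⇒≢ t<αn+c*p-1 (trans (sym (+-identityʳ _)) carries))
  CarrySplit⇒0<right record { right = suc _ } _ = z<s

  CarrySplit-digit : ∀ {x t c} d → d < p → CarrySplit x t c → CarrySplit (d + x * p) (d + t) c
  CarrySplit-digit {x} {t} {c} d d<p s = record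
    { left       = d + m * p
    ; right      = r * p
    ; left+right = trans (+-assoc d (m * p) (r * p))
                     (cong (d +_) (trans (sym (*-distribʳ-+ p m r)) (cong (_* p) left+right)))
    ; α-left     = trans (α-digit d m d<p) (cong (d +_) α-left)
    ; carries    = begin
        α p (d + m * p) + α p (r * p)  ≡⟨ cong₂ _+_ (α-digit d m d<p) (α-*p r) ⟩
        d + α p m + α p r              ≡⟨ +-assoc d (α p m) (α p r) ⟩
        d + (α p m + α p r)            ≡⟨ cong (d +_) carries ⟩
        d + (α p x + c * p-1)          ≡⟨ +-assoc d (α p x) (c * p-1) ⟨
        d + α p x + c * p-1            ≡⟨ cong (_+ c * p-1) (α-digit d x d<p) ⟨
        α p (d + x * p) + c * p-1      ∎
    }
    where
    open CarrySplit s renaming (left to m; right to r)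
    open ≡-Reasoning

  split-no-carry : ∀ n t → t ≤ α p n → CarrySplit n t 0
  split-no-carry = digit-induction (λ n → ∀ t → t ≤ α p n → CarrySplit n t 0) base step
    where
    base : ∀ t → t ≤ α p 0 → CarrySplit 0 t 0
    base zero _ = record { left = 0 ; right = 0 ; left+right = refl ; α-left = refl ; carries = refl }

    step : ∀ d x → d < p → (∀ t → t ≤ α p x → CarrySplit x t 0) →
           ∀ t → t ≤ α p (d + x * p) → CarrySplit (d + x * p) t 0
    step d x d<p ih t t≤αn with ≤-total t d
    ... | inj₂ d≤t with m≤n⇒∃[o]m+o≡n d≤t
    ...   | t′ , refl = CarrySplit-digit d d<p
                          (ih t′ (+-cancelˡ-≤ d t′ (α p x) (subst (d + t′ ≤_) (α-digit d x d<p) t≤αn)))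
    step d x d<p ih t t≤αn | inj₁ t≤d with m≤n⇒∃[o]m+o≡n t≤d
    ...   | j , refl = record
      { left       = t
      ; right      = j + x * p
      ; left+right = sym (+-assoc t j (x * p))
      ; α-left     = α-single-digit t t<p
      ; carries    = begin
          α p t + α p (j + x * p)  ≡⟨ cong₂ _+_ (α-single-digit t t<p) (α-digit j x (≤-<-trans (m≤n+m j t) d<p)) ⟩
          t + (j + α p x)          ≡⟨ +-assoc t j (α p x) ⟨
          t + j + α p x            ≡⟨ α-digit (t + j) x d<p ⟨
          α p (t + j + x * p)      ≡⟨ +-identityʳ _ ⟨
          α p (t + j + x * p) + 0  ∎
      }
      where
      open ≡-Reasoning
      t<p : t < p
      t<p = ≤-<-trans (m≤m+n t j) d<p

  -- The carry comes from the digit x: the low digits suc (d + j) and suc (d + a + k) add up to d + p.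
  private
    split-one-carry-indivisible : ∀ d x′ t → d < p → α p (suc x′) ≡ suc (α p x′) →
      d + suc (α p x′) ≤ t → t < p → CarrySplit (d + suc x′ * p) t 1
    split-one-carry-indivisible d x′ t d<p α[1+x′]≡ αn≤t t<p
      with m≤n⇒∃[o]m+o≡n αn≤t | m≤n⇒∃[o]m+o≡n t<p
    ... | j , refl | k , p≡ = record
      { left       = suc (d + j) + x′ * p
      ; right      = suc (d + a + k)
      ; left+right = begin
          suc (d + j) + x′ * p + suc (d + a + k)           ≡⟨ sum-rearrange d j a k (x′ * p) ⟩
          d + (suc (d + suc a + j) + k + x′ * p)           ≡⟨ cong (λ z → d + (z + x′ * p)) p≡ ⟩
          d + suc x′ * p                                   ∎
      ; α-left     = trans (α-digit (suc (d + j)) x′ low<p) (digit-rearrange d j a)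
      ; carries    = begin
          α p (suc (d + j) + x′ * p) + α p (suc (d + a + k))
            ≡⟨ cong₂ _+_ (α-digit (suc (d + j)) x′ low<p) (α-single-digit _ high<p) ⟩
          suc (d + j) + a + suc (d + a + k)                ≡⟨ carry-rearrange d j a k ⟩
          d + suc a + (d + suc a + j + k + 0)              ≡⟨ cong₂ (λ u v → d + u + (v + 0)) (sym α[1+x′]≡) p-1≡ ⟩
          d + α p (suc x′) + (p-1 + 0)                     ≡⟨ cong (_+ (p-1 + 0)) (α-digit d (suc x′) d<p) ⟨
          α p (d + suc x′ * p) + 1 * p-1                   ∎
      }
      where
      open ≡-Reasoning
      a = α p x′
      p-1≡ : d + suc a + j + k ≡ p-1
      p-1≡ = cong pred p≡
      sum-rearrange : ∀ d j a k y → suc (d + j) + y + suc (d + a + k) ≡ d + (suc (d + suc a + j) + k + y)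
      sum-rearrange = solve-∀
      digit-rearrange : ∀ d j a → suc (d + j) + a ≡ d + suc a + j
      digit-rearrange = solve-∀
      carry-rearrange : ∀ d j a k → suc (d + j) + a + suc (d + a + k) ≡ d + suc a + (d + suc a + j + k + 0)
      carry-rearrange = solve-∀
      low<p : suc (d + j) < p
      low<p = ≤-<-trans (subst (suc (d + j) ≤_) (digit-rearrange d j a) (m≤m+n _ a)) t<p
      high<p : suc (d + a + k) < p
      high<p = subst (suc (d + a + k) <_) p≡ (subst (suc (suc (d + a + k)) ≤_) (high-rearrange d j a k) (m≤m+n _ j))
        where
        high-rearrange : ∀ d j a k → suc (suc (d + a + k)) + j ≡ suc (d + suc a + j) + k
        high-rearrange = solve-∀

  split-one-carry : ∀ n t → p ≤ n → α p n ≤ t → t < p → CarrySplit n t 1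
  split-one-carry = digit-induction (λ n → ∀ t → p ≤ n → α p n ≤ t → t < p → CarrySplit n t 1) base step
    where
    base : ∀ t → p ≤ 0 → α p 0 ≤ t → t < p → CarrySplit 0 t 1
    base t p≤0 = ⊥-elim (<⇒≱ 0<p p≤0)

    step : ∀ d x → d < p → (∀ t → p ≤ x → α p x ≤ t → t < p → CarrySplit x t 1) →
           ∀ t → p ≤ d + x * p → α p (d + x * p) ≤ t → t < p → CarrySplit (d + x * p) t 1
    step d zero d<p _ _ p≤n = ⊥-elim (<⇒≱ d<p (subst (p ≤_) (+-identityʳ d) p≤n))
    step d x@(suc x′) d<p ih t p≤n αn≤t t<p with p ∣? x
    ... | no p∤x = split-one-carry-indivisible d x′ t d<p (α-pred-indivisible x p∤x)
                     (subst (_≤ t) (trans (α-digit d x d<p) (cong (d +_) (α-pred-indivisible x p∤x))) αn≤t) t<p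
    ... | yes p∣x with m≤n⇒∃[o]m+o≡n (subst (_≤ t) (α-digit d x d<p) αn≤t)
    ...   | j , refl = subst (λ t → CarrySplit (d + x * p) t 1) (sym (+-assoc d (α p x) j))
                         (CarrySplit-digit d d<p (ih (α p x + j) (∣⇒≤ p∣x) (m≤m+n (α p x) j) t′<p))
      where
      t′<p : α p x + j < p
      t′<p = ≤-<-trans (m≤n+m _ d) (subst (_< p) (+-assoc d (α p x) j) t<p)

C*!*!≡! : ∀ m r → ((m + r) C m) * (m ! * r !) ≡ (m + r) !
C*!*!≡! m r = subst (λ k → ((m + r) C m) * (m ! * k !) ≡ (m + r) !) (m+n∸m≡n m r) C*!*!≡!′
  where
  instance
    m!*[m+r∸m]!≢0 : NonZero (m ! * (m + r ∸ m) !)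
    m!*[m+r∸m]!≢0 = m !* (m + r ∸ m) !≢0
  C*!*!≡!′ : ((m + r) C m) * (m ! * (m + r ∸ m) !) ≡ (m + r) !
  C*!*!≡!′ = trans (cong (_* (m ! * (m + r ∸ m) !)) (nCk≡n!/k![n-k]! (m≤m+n m r)))
                   (m/n*n≡m (k![n∸k]!∣n! (m≤m+n m r)))

0<C : ∀ m r → 0 < (m + r) C m
0<C m r = n≢0⇒n>0 (λ C≡0 → ≢-nonZero⁻¹ ((m + r) !) {{(m + r) !≢0}}
            (trans (sym (C*!*!≡! m r)) (cong (_* (m ! * r !)) C≡0)))

module Kummer {p : ℕ} (pr : Prime p) where

  private
    instance
      p≢0 : NonZero p
      p≢0 = prime⇒nonZero pr

  1<p : 1 < p
  1<p = nonTrivial⇒n>1 p {{prime⇒nonTrivial pr}}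

  open DigitSum p 1<p

  legendre : ∀ n → ∃[ e ] Valuation p (n !) e × e * p-1 + α p n ≡ n
  legendre zero = 0 , valuation 1 refl (λ p∣1 → <⇒≢ 1<p (sym (∣1⇒≡1 p∣1))) , refl
  legendre (suc n) with legendre n | valuation-exists 1<p (suc n) z<s
  ... | e , vₑ , e*p-1+αn≡n | v , vᵥ = v + e , Valuation-* pr vᵥ vₑ , (begin
    (v + e) * p-1 + α p (suc n)        ≡⟨ rearrange v e p-1 (α p (suc n)) ⟩
    e * p-1 + (α p (suc n) + v * p-1)  ≡⟨ cong (e * p-1 +_) (α-pred-valuation vᵥ) ⟩
    e * p-1 + suc (α p n)              ≡⟨ +-suc (e * p-1) (α p n) ⟩
    suc (e * p-1 + α p n)              ≡⟨ cong suc e*p-1+αn≡n ⟩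
    suc n                              ∎)
    where
    open ≡-Reasoning
    rearrange : ∀ v e q a → (v + e) * q + a ≡ e * q + (a + v * q)
    rearrange = solve-∀

  kummer : ∀ m r {c} → Valuation p ((m + r) C m) c → α p m + α p r ≡ α p (m + r) + c * p-1
  kummer m r {c} v_c with legendre (m + r) | legendre m | legendre r
  ... | e , vₑ , legendreₙ | e₁ , v₁ , legendre₁ | e₂ , v₂ , legendre₂ = carries
    where
    open ≡-Reasoning
    c+e₁+e₂≡e : c + (e₁ + e₂) ≡ e
    c+e₁+e₂≡e = Valuation-unique
      (subst (λ k → Valuation p k (c + (e₁ + e₂))) (C*!*!≡! m r) (Valuation-* pr v_c (Valuation-* pr v₁ v₂))) vₑ
    rearrange₁ : ∀ a b x y → a + b + (x + y) ≡ x + a + (y + b)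
    rearrange₁ = solve-∀
    rearrange₂ : ∀ c e₁ e₂ q s → (c + (e₁ + e₂)) * q + s ≡ s + c * q + (e₁ * q + e₂ * q)
    rearrange₂ = solve-∀
    carries : α p m + α p r ≡ α p (m + r) + c * p-1
    carries = +-cancelʳ-≡ (e₁ * p-1 + e₂ * p-1) _ _ (begin
      α p m + α p r + (e₁ * p-1 + e₂ * p-1)            ≡⟨ rearrange₁ (α p m) (α p r) (e₁ * p-1) (e₂ * p-1) ⟩
      e₁ * p-1 + α p m + (e₂ * p-1 + α p r)            ≡⟨ cong₂ _+_ legendre₁ legendre₂ ⟩
      m + r                                            ≡⟨ legendreₙ ⟨
      e * p-1 + α p (m + r)                            ≡⟨ cong (λ k → k * p-1 + α p (m + r)) c+e₁+e₂≡e ⟨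
      (c + (e₁ + e₂)) * p-1 + α p (m + r)              ≡⟨ rearrange₂ c e₁ e₂ p-1 (α p (m + r)) ⟩
      α p (m + r) + c * p-1 + (e₁ * p-1 + e₂ * p-1)    ∎)

  C-valuation : ∀ m r → ∃[ c ] Valuation p ((m + r) C m) c
  C-valuation m r = valuation-exists 1<p ((m + r) C m) (0<C m r)

  kummer-exact : ∀ m r c → α p m + α p r ≡ α p (m + r) + c * p-1 → Valuation p ((m + r) C m) c
  kummer-exact m r c carries = subst (Valuation p ((m + r) C m)) c′≡c v
    where
    c′ = proj₁ (C-valuation m r)
    v  = proj₂ (C-valuation m r)
    c′≡c : c′ ≡ c
    c′≡c = *-cancelʳ-≡ c′ c p-1 (+-cancelˡ-≡ (α p (m + r)) (c′ * p-1) (c * p-1) (trans (sym (kummer m r v)) carries))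

  kummer-divides : ∀ m r → α p (m + r) < α p m + α p r → p ∣ (m + r) C m
  kummer-divides m r αn<αm+αr = p∣C (C-valuation m r)
    where
    p∣C : ∃[ c ] Valuation p ((m + r) C m) c → p ∣ (m + r) C m
    p∣C (zero  , v) = ⊥-elim (<⇒≢ αn<αm+αr (trans (sym (+-identityʳ (α p (m + r)))) (sym (kummer m r v))))
    p∣C (suc c , v) = ∣-trans (m∣m*n (p ^ c)) (Valuation⇒p^e∣ v)

gcdList-greatest : ∀ {d} xs → (∀ {x} → x ∈ xs → d ∣ x) → d ∣ gcdList xs
gcdList-greatest []       _   = _ ∣0
gcdList-greatest (x ∷ xs) d∣x = gcd-greatest (d∣x (here refl)) (gcdList-greatest xs (d∣x ∘ there))

gcdList∣ : ∀ {x} xs → x ∈ xs → gcdList xs ∣ x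
gcdList∣ (x ∷ xs) (here refl) = gcd[m,n]∣m x (gcdList xs)
gcdList∣ (y ∷ xs) (there x∈)  = ∣-trans (gcd[m,n]∣n y (gcdList xs)) (gcdList∣ xs x∈)

module _ {n q : ℕ} .{{_ : NonZero q}} where

  private
    multiples : List ℕ
    multiples = filter (λ k → q * k <? n) (map suc (upTo n))

    gcdBinom∣C-multiple : ∀ {k} → 0 < k → q * k < n → gcdBinom n q ∣ n C (q * k)
    gcdBinom∣C-multiple {suc i} _ qk<n =
      gcdList∣ _ (∈-map⁺ (λ k → n C (q * k)) (∈-filter⁺ (λ k → q * k <? n) (∈-map⁺ suc (∈-upTo⁺ i<n)) qk<n))
      where
      i<n : i < n
      i<n = <-≤-trans (n<1+n i) (≤-trans (m≤n*m (suc i) q) (<⇒≤ qk<n))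

  gcdBinom∣C : ∀ {m r} → m + r ≡ n → 0 < m → 0 < r → q ∣ m → gcdBinom n q ∣ (m + r) C m
  gcdBinom∣C {r = r} refl 0<m 0<r (divides k refl) =
    subst (λ j → gcdBinom (k * q + r) q ∣ (k * q + r) C j) (*-comm q k)
      (gcdBinom∣C-multiple (n≢0⇒n>0 λ { refl → <-irrefl refl 0<m })
        (subst (_< k * q + r) (*-comm k q) (m<m+n (k * q) 0<r)))

  ∣gcdBinom : ∀ {d} → (∀ m r → m + r ≡ n → 0 < m → 0 < r → q ∣ m → d ∣ (m + r) C m) → d ∣ gcdBinom n q
  ∣gcdBinom {d} d∣C = gcdList-greatest _ d∣
    where
    d∣C-multiple : ∀ k → 0 < k → q * k < n → d ∣ n C (q * k)
    d∣C-multiple k 0<k qk<n = subst (λ x → d ∣ x C (q * k)) m+r≡n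
      (d∣C (q * k) (n ∸ q * k) m+r≡n (≤-trans 0<k (m≤n*m k q)) (m<n⇒0<n∸m qk<n) (m∣m*n k))
      where
      m+r≡n : q * k + (n ∸ q * k) ≡ n
      m+r≡n = m+[n∸m]≡n (<⇒≤ qk<n)
    d∣ : ∀ {x} → x ∈ map (λ k → n C (q * k)) multiples → d ∣ x
    d∣ x∈ with ∈-map⁻ (λ k → n C (q * k)) x∈
    ... | k , k∈ , refl with ∈-filter⁻ (λ k → q * k <? n) {xs = map suc (upTo n)} k∈
    ...   | k∈′ , qk<n with ∈-map⁻ suc k∈′
    ...     | i , _ , refl = d∣C-multiple (suc i) z<s qk<n

%≡1%⇒∣pred : ∀ {p q} .{{_ : NonZero q}} → p % q ≡ 1 % q → q ∣ pred p
%≡1%⇒∣pred {p} {suc zero}        _      = 1∣ pred p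
%≡1%⇒∣pred {p} {q@(suc (suc _))} p%q≡1 =
  divides (p / q) (cong pred (trans (m≡m%n+[m/n]*n p q) (cong (_+ p / q * q) p%q≡1)))

module _ {q p : ℕ} .{{_ : NonZero q}} (pr : Prime p) (q∣p-1 : q ∣ pred p) where

  private
    instance
      p≢0 : NonZero p
      p≢0 = prime⇒nonZero pr

  open Kummer pr
  open DigitSum p 1<p

  q<p : q < p
  q<p = ≤-<-trans (∣⇒≤ q∣p-1) p-1<p

  q≤α : ∀ {m} → 0 < m → q ∣ m → q ≤ α p m
  q≤α {m} 0<m q∣m = ∣⇒≤ {{>-nonZero (α-positive m 0<m)}} (∣⇒∣α q∣p-1 q∣m)

  p∣gcdBinom : ∀ {n} → α p n ≤ q → p ∣ gcdBinom n q
  p∣gcdBinom {n} αn≤q = ∣gcdBinom {n} λ m r m+r≡n 0<m 0<r q∣m → kummer-divides m r (begin-strict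
    α p (m + r)     ≡⟨ cong (α p) m+r≡n ⟩
    α p n           ≤⟨ αn≤q ⟩
    q               ≤⟨ q≤α 0<m q∣m ⟩
    α p m           <⟨ m<m+n (α p m) (α-positive r 0<r) ⟩
    α p m + α p r   ∎)
    where open ≤-Reasoning

  ¬p^[1+c]∣gcdBinom : ∀ {n c} (s : CarrySplit n q c) → 0 < CarrySplit.right s → ¬ p ^ suc c ∣ gcdBinom n q
  ¬p^[1+c]∣gcdBinom {n} {c} s 0<r p^[1+c]∣G =
    Valuation⇒¬p^[1+e]∣ (kummer-exact m r c carries′) (∣-trans p^[1+c]∣G (gcdBinom∣C left+right 0<m 0<r q∣m))
    where
    open CarrySplit s renaming (left to m; right to r)
    carries′ : α p m + α p r ≡ α p (m + r) + c * p-1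
    carries′ = subst (λ k → α p m + α p r ≡ α p k + c * p-1) (sym left+right) carries
    q∣m : q ∣ m
    q∣m = ∣α⇒∣ q∣p-1 (subst (q ∣_) (sym α-left) ∣-refl)
    0<m : 0 < m
    0<m = n≢0⇒n>0 λ m≡0 → ≢-nonZero⁻¹ q (trans (sym α-left) (cong (α p) m≡0))

  gcdBinom-ord-1 : ∀ {n} → q < n → α p n ≤ q → IsOrd p (gcdBinom n q) 1
  gcdBinom-ord-1 {n} q<n αn≤q =
    subst (_∣ gcdBinom n q) (sym (*-identityʳ p)) (p∣gcdBinom {n} αn≤q) ,
    ¬p^[1+c]∣gcdBinom s (CarrySplit⇒0<right s q<αn+p-1)
    where
    p≤n : p ≤ n
    p≤n = ≮⇒≥ λ n<p → <⇒≱ q<n (subst (_≤ q) (α-single-digit n n<p) αn≤q)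
    s : CarrySplit n q 1
    s = split-one-carry n q p≤n αn≤q q<p
    q<αn+p-1 : q < α p n + 1 * p-1
    q<αn+p-1 = ≤-<-trans (≤-trans (∣⇒≤ q∣p-1) (m≤m+n p-1 0)) (m<n+m _ (α-positive n (<-≤-trans 0<p p≤n)))

  gcdBinom-ord-0 : ∀ {n} → q < α p n → IsOrd p (gcdBinom n q) 0
  gcdBinom-ord-0 {n} q<αn = 1∣ _ , ¬p^[1+c]∣gcdBinom s (CarrySplit⇒0<right s (≤-trans q<αn (m≤m+n _ 0)))
    where
    s : CarrySplit n q 0
    s = split-no-carry n q (<⇒≤ q<αn)

theoremQ : (n q p : ℕ) → 0 < q → q < n → .{{_ : NonZero q}} → Prime p → .{{_ : NonZero p}} →
    p % q ≡ 1 % q →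
    IsOrd p (gcdBinom n q) (if α p n ≤ᵇ q then 1 else 0)
theoremQ n q p _ q<n pr p%q≡1%q with α p n ≤ᵇ q | ≤ᵇ-reflects-≤ (α p n) q
... | true  | ofʸ αn≤q = gcdBinom-ord-1 pr (%≡1%⇒∣pred p%q≡1%q) q<n αn≤q
... | false | ofⁿ αn≰q = gcdBinom-ord-0 pr (%≡1%⇒∣pred p%q≡1%q) {n} (≰⇒> αn≰q)
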